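{- Let $G$ be a connected finite simple graph with $\mathrm{ind\text{ - }match}(G)\ge 2$ and $\mathrm{min\text{ - }match}(G)=\mathrm{match}(G)$. Then $G$ has no perfect matching.
   Context: A matching is a set of pairwise disjoint edges; it is perfect if every vertex lies in one of its edges. A maximal matching is one not properly contained in another matching; an induced matching is a matching $M$ such that for distinct $e,f\in M$ there is no edge meeting both $e$ and $f$. $\mathrm{match}$, $\mathrm{min\text{ - }match}$, $\mathrm{ind\text{ - }match}$ are the maximum size of a matching, the minimum size of a maximal matching, and the maximum size of an induced matching. -}

module Defs where

open import Data.Nat using (ℕ; _≤_; suc)
open import Data.Fin using (Fin)
open import Data.Product using (_×_; _,_; Σ; ∃; proj₁; proj₂; swap)
open import Data.Sum using (_⊎_)
open import Data.List using (List; length)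
open import Data.List.Relation.Unary.All using (All)
open import Data.List.Relation.Unary.Any using (Any)
open import Data.List.Relation.Unary.AllPairs using (AllPairs)
open import Relation.Nullary using (¬_)
open import Relation.Binary.PropositionalEquality using (_≡_)
open import Level using (0ℓ) renaming (suc to lsuc)

record Graph (n : ℕ) : Set₁ where
  field
    Adj   : Fin n → Fin n → Set
    sym   : ∀ {u v} → Adj u v → Adj v u
    irrefl : ∀ {u} → ¬ Adj u u
open Graph public

data Walk {n : ℕ} (G : Graph n) : Fin n → Fin n → Set where
  here : ∀ {u} → Walk G u u
  step : ∀ {u v w} → Adj G u v → Walk G v w → Walk G u w

Connected : ∀ {n} → Graph n → Set
Connected {n} G = (u v : Fin n) → Walk G u v

-- An edge is represented by an (oriented) pair of vertices.
Edge : ℕ → Set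
Edge n = Fin n × Fin n

_∈ₑ_ : ∀ {n} → Fin n → Edge n → Set
x ∈ₑ e = (x ≡ proj₁ e) ⊎ (x ≡ proj₂ e)

SameEdge : ∀ {n} → Edge n → Edge n → Set
SameEdge e f = (e ≡ f) ⊎ (swap e ≡ f)

Disjoint : ∀ {n} → Edge n → Edge n → Set
Disjoint e f = ∀ x → x ∈ₑ e → ¬ (x ∈ₑ f)

-- A matching: a list of edges of G that are pairwise disjoint.
-- (Pairwise disjointness forbids repeated edges, so length = size.)
IsMatching : ∀ {n} → Graph n → List (Edge n) → Set
IsMatching G M = All (λ e → Adj G (proj₁ e) (proj₂ e)) M × AllPairs Disjoint M

_⊆ₘ_ : ∀ {n} → List (Edge n) → List (Edge n) → Set
M ⊆ₘ M' = All (λ e → Any (SameEdge e) M') M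

_⊂ₘ_ : ∀ {n} → List (Edge n) → List (Edge n) → Set
M ⊂ₘ M' = (M ⊆ₘ M') × ∃ λ f → Any (SameEdge f) M' × ¬ Any (SameEdge f) M

IsMaximalMatching : ∀ {n} → Graph n → List (Edge n) → Set
IsMaximalMatching G M =
  IsMatching G M × (∀ M' → IsMatching G M' → ¬ (M ⊂ₘ M'))

NotJoined : ∀ {n} → Graph n → Edge n → Edge n → Set
NotJoined G e f = ∀ x y → x ∈ₑ e → y ∈ₑ f → ¬ Adj G x y

IsInducedMatching : ∀ {n} → Graph n → List (Edge n) → Set
IsInducedMatching G M = IsMatching G M × AllPairs (NotJoined G) M

IsPerfectMatching : ∀ {n} → Graph n → List (Edge n) → Set
IsPerfectMatching {n} G M = IsMatching G M × (∀ (x : Fin n) → Any (x ∈ₑ_) M)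

IsMatchNumber : ∀ {n} → Graph n → ℕ → Set
IsMatchNumber G k =
  (∃ λ M → IsMatching G M × length M ≡ k) ×
  (∀ M → IsMatching G M → length M ≤ k)

IsMinMatchNumber : ∀ {n} → Graph n → ℕ → Set
IsMinMatchNumber G k =
  (∃ λ M → IsMaximalMatching G M × length M ≡ k) ×
  (∀ M → IsMaximalMatching G M → k ≤ length M)

IsIndMatchNumber : ∀ {n} → Graph n → ℕ → Set
IsIndMatchNumber G k =
  (∃ λ M → IsInducedMatching G M × length M ≡ k) ×
  (∀ M → IsInducedMatching G M → length M ≤ k)

{-# OPTIONS --safe #-}
-- Let P be a perfect matching of a graph in which every maximal matching is
-- maximum. The two ends of a path alternating between edges of P and other
-- edges, starting and ending in P, are adjacent: exchanging the edges along the
-- path gives a smaller matching that misses only the two ends, and it would be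
-- maximal if they were not adjacent. Paths through two or three edges of P show
-- that "some endpoint of e is adjacent to some endpoint of f" is transitive on
-- the edges of P, so in a connected graph any two edges of P are joined by an
-- edge. The two-edge exchange also moves any edge into a perfect matching while
-- keeping the edges disjoint from it; moving in both edges of an induced
-- matching produces two edges of a perfect matching that are not joined.
module Submission where

open import Defs
open import Data.Nat using (ℕ; _≤_; _<_; suc; _*_; s≤s)
open import Data.Nat.Properties using (≤-trans; ≤-reflexive; <⇒≱; *-suc; *-cancelˡ-≡)
open import Data.Fin using (Fin)
open import Data.Fin.Properties using (_≟_)
open import Data.List using (List; []; _∷_; _++_; length)
open import Data.List.Relation.Unary.All as All using (All; []; _∷_)
open import Data.List.Relation.Unary.All.Properties using (All¬⇒¬Any; ¬Any⇒All¬; ++⁺; ++⁻ʳ)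
open import Data.List.Relation.Unary.Any using (Any; here; there)
open import Data.List.Relation.Unary.AllPairs using (AllPairs; []; _∷_)
open import Data.List.Relation.Unary.Unique.Propositional using (Unique)
open import Data.List.Relation.Binary.Pointwise as Pointwise using (Pointwise; []; _∷_)
open import Data.List.Membership.Propositional using (_∈_; _∉_; find; lose)
open import Data.List.Membership.Propositional.Properties using (∈-∃++; ∈-++⁻)
open import Data.List.Relation.Binary.Permutation.Propositional
  using (_↭_; refl; prep; swap; trans; ↭⇒↭ₛ; module PermutationReasoning)
open import Data.List.Relation.Binary.Permutation.Propositional.Properties
  using (∈-resp-↭; All-resp-↭; ↭-length; shift; shifts; ++⁺ˡ; ++⁺ʳ)
import Data.List.Relation.Binary.Permutation.Setoid.Properties as SetoidPermutation
open import Data.Product using (_×_; _,_; ∃; ∃₂; proj₁; proj₂)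
open import Data.Product.Properties using (≡-dec)
import Data.Sum as Sum
open Sum using (_⊎_; inj₁; inj₂)
open import Effect.Monad using (RawMonad)
open import Level using (0ℓ)
open import Data.Empty using (⊥)
open import Relation.Nullary using (¬_; Dec; yes; no)
open import Relation.Nullary.Negation using (¬¬-Monad; contradiction)
open import Relation.Binary.PropositionalEquality as ≡ using (_≡_; _≢_; refl; cong)

-- Adjacency is not decidable, so the argument runs in the double-negation
-- monad; the theorem is a negation, so nothing is lost.
open RawMonad (¬¬-Monad {0ℓ}) using (return; _>>=_; _<$>_)

private variable
  n : ℕ

module _ {A : Set} where

  private variable
    x : A
    xs ys zs : List A

  ∈⇒↭∷ : x ∈ xs → ∃ λ ys → xs ↭ x ∷ ys
  ∈⇒↭∷ x∈xs with ys , zs , refl ← ∈-∃++ x∈xs = ys ++ zs , shift _ ys zs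

  Unique-resp-↭ : Unique xs → xs ↭ ys → Unique ys
  Unique-resp-↭ unique σ = SetoidPermutation.Unique-resp-↭ (≡.setoid A) (↭⇒↭ₛ σ) unique

  ∈-↭-++⁻ : xs ↭ ys ++ zs → x ∈ xs → x ∉ ys → x ∈ zs
  ∈-↭-++⁻ {ys = ys} σ x∈xs x∉ys with ∈-++⁻ ys (∈-resp-↭ σ x∈xs)
  ... | inj₁ x∈ys = contradiction x∈ys x∉ys
  ... | inj₂ x∈zs = x∈zs

  Unique⊆⇒↭++ : Unique ys → All (_∈ xs) ys → ∃ λ zs → xs ↭ ys ++ zs
  Unique⊆⇒↭++ {ys = []} {xs} [] [] = xs , refl
  Unique⊆⇒↭++ {ys = y ∷ ys} (y∉ys ∷ ys-unique) (y∈xs ∷ ys⊆xs)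
    with zs , σ ← Unique⊆⇒↭++ ys-unique ys⊆xs
    with zs′ , τ ← ∈⇒↭∷ (∈-↭-++⁻ σ y∈xs (All¬⇒¬Any y∉ys))
    = zs′ , trans σ (trans (++⁺ˡ ys τ) (shift y ys zs′))

vertices : List (Edge n) → List (Fin n)
vertices [] = []
vertices ((x , y) ∷ M) = x ∷ y ∷ vertices M

private variable
  u u′ v v′ w : Fin n
  e e′ f g : Edge n
  M N P R : List (Edge n)

vertices-++ : ∀ M → vertices (M ++ N) ≡ vertices M ++ vertices N
vertices-++ [] = refl
vertices-++ ((x , y) ∷ M) = cong (λ vs → x ∷ y ∷ vs) (vertices-++ M)

length-vertices : ∀ M → length (vertices {n} M) ≡ 2 * length M
length-vertices [] = refl
length-vertices (_ ∷ M) = ≡.trans (cong (λ l → suc (suc l)) (length-vertices M)) (≡.sym (*-suc 2 (length M)))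

∈-vertices⁺ : Any (u ∈ₑ_) M → u ∈ vertices M
∈-vertices⁺ (here (inj₁ u≡x)) = here u≡x
∈-vertices⁺ (here (inj₂ u≡y)) = there (here u≡y)
∈-vertices⁺ (there u∈M) = there (there (∈-vertices⁺ u∈M))

∈-vertices⁻ : u ∈ vertices M → Any (u ∈ₑ_) M
∈-vertices⁻ {M = _ ∷ _} (here u≡x) = here (inj₁ u≡x)
∈-vertices⁻ {M = _ ∷ _} (there (here u≡y)) = here (inj₂ u≡y)
∈-vertices⁻ {M = _ ∷ _} (there (there u∈M)) = there (∈-vertices⁻ u∈M)

vertices-↭ : M ↭ N → vertices M ↭ vertices N
vertices-↭ refl = refl
vertices-↭ (prep (x , y) σ) = prep x (prep y (vertices-↭ σ))
vertices-↭ (swap (x , y) (z , w) σ) =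
  trans (shifts (x ∷ y ∷ []) (z ∷ w ∷ [])) (++⁺ˡ (z ∷ w ∷ x ∷ y ∷ []) (vertices-↭ σ))
vertices-↭ (trans σ τ) = trans (vertices-↭ σ) (vertices-↭ τ)

vertices-↭-∷∷⇒< : vertices M ↭ u ∷ v ∷ vertices N → length N < length M
vertices-↭-∷∷⇒< {M = M} {N = N} σ = ≤-reflexive (≡.sym (*-cancelˡ-≡ (length M) (suc (length N)) 2 (begin
  2 * length M               ≡⟨ length-vertices M ⟨
  length (vertices M)        ≡⟨ ↭-length σ ⟩
  suc (suc (length (vertices N))) ≡⟨ cong (λ l → suc (suc l)) (length-vertices N) ⟩
  suc (suc (2 * length N))   ≡⟨ *-suc 2 (length N) ⟨
  2 * suc (length N)         ∎)))
  where open ≡.≡-Reasoning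

SameEdge-refl : SameEdge e e
SameEdge-refl = inj₁ refl

SameEdge-sym : SameEdge e f → SameEdge f e
SameEdge-sym (inj₁ refl) = inj₁ refl
SameEdge-sym (inj₂ refl) = inj₂ refl

SameEdge-trans : SameEdge e f → SameEdge f g → SameEdge e g
SameEdge-trans (inj₁ refl) s = s
SameEdge-trans (inj₂ refl) (inj₁ refl) = inj₂ refl
SameEdge-trans (inj₂ refl) (inj₂ refl) = inj₁ refl

∈ₑ-resp-SameEdge : SameEdge e f → u ∈ₑ e → u ∈ₑ f
∈ₑ-resp-SameEdge (inj₁ refl) = λ u∈e → u∈e
∈ₑ-resp-SameEdge (inj₂ refl) = Sum.swap

∈ₑ⇒SameEdge : u ∈ₑ e → ∃ λ v → SameEdge e (u , v)
∈ₑ⇒SameEdge {e = _ , y} (inj₁ refl) = y , inj₁ refl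
∈ₑ⇒SameEdge {e = x , _} (inj₂ refl) = x , inj₂ refl

endpoints⇒SameEdge : u ∈ₑ e → v ∈ₑ e → u ≢ v → SameEdge e (u , v)
endpoints⇒SameEdge (inj₁ refl) (inj₁ refl) u≢v = contradiction refl u≢v
endpoints⇒SameEdge (inj₁ refl) (inj₂ refl) _ = inj₁ refl
endpoints⇒SameEdge (inj₂ refl) (inj₁ refl) _ = inj₂ refl
endpoints⇒SameEdge (inj₂ refl) (inj₂ refl) u≢v = contradiction refl u≢v

_≟ₑ_ : (e f : Edge n) → Dec (e ≡ f)
_≟ₑ_ = ≡-dec _≟_ _≟_

vertices-resp-SameEdge : Pointwise SameEdge M N → vertices M ↭ vertices N
vertices-resp-SameEdge [] = refl
vertices-resp-SameEdge (inj₁ refl ∷ ss) = prep _ (prep _ (vertices-resp-SameEdge ss))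
vertices-resp-SameEdge (inj₂ refl ∷ ss) = swap _ _ (vertices-resp-SameEdge ss)

All-Disjoint⇒∉vertices : All (Disjoint e) M → u ∈ₑ e → u ∉ vertices M
All-Disjoint⇒∉vertices disjoint u∈e u∈M = All¬⇒¬Any (All.map (λ d → d _ u∈e) disjoint) (∈-vertices⁻ u∈M)

∉vertices⇒All-Disjoint : (∀ {u} → u ∈ₑ e → u ∉ vertices M) → All (Disjoint e) M
∉vertices⇒All-Disjoint ∉M = All.tabulate λ f∈M u u∈e u∈f → ∉M u∈e (∈-vertices⁺ (lose {P = _ ∈ₑ_} f∈M u∈f))

Disjoint⇒≢ : Disjoint e f → u ∈ₑ e′ → u ∈ₑ f → e ≢ e′
Disjoint⇒≢ e#f u∈e′ u∈f refl = e#f _ u∈e′ u∈f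

shared-endpoint⇒≡ : AllPairs Disjoint M → e ∈ M → f ∈ M → u ∈ₑ e → u ∈ₑ f → e ≡ f
shared-endpoint⇒≡ (_ ∷ _) (here refl) (here refl) _ _ = refl
shared-endpoint⇒≡ (disjoint ∷ _) (here refl) (there f∈M) u∈e u∈f = contradiction u∈f (All.lookup disjoint f∈M _ u∈e)
shared-endpoint⇒≡ (disjoint ∷ _) (there e∈M) (here refl) u∈e u∈f = contradiction u∈e (All.lookup disjoint e∈M _ u∈f)
shared-endpoint⇒≡ (_ ∷ pairwise) (there e∈M) (there f∈M) = shared-endpoint⇒≡ pairwise e∈M f∈M

module _ {n} (G : Graph n) where

  AllEdges : List (Edge n) → Set
  AllEdges M = All (λ e → Adj G (proj₁ e) (proj₂ e)) M

  Adj-resp-SameEdge : SameEdge e f → Adj G (proj₁ e) (proj₂ e) → Adj G (proj₁ f) (proj₂ f)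
  Adj-resp-SameEdge (inj₁ refl) = λ a → a
  Adj-resp-SameEdge (inj₂ refl) = sym G

  AllEdges-resp-SameEdge : Pointwise SameEdge M N → AllEdges M → AllEdges N
  AllEdges-resp-SameEdge [] [] = []
  AllEdges-resp-SameEdge (s ∷ ss) (a ∷ as) = Adj-resp-SameEdge s a ∷ AllEdges-resp-SameEdge ss as

  Adj⇒≢ : Adj G u v → u ≢ v
  Adj⇒≢ uv refl = irrefl G uv

  matching⇒unique : IsMatching G M → Unique (vertices M)
  matching⇒unique {M = []} _ = []
  matching⇒unique {M = (x , y) ∷ M} (xy ∷ edges , disjoint ∷ pairwise) =
    (Adj⇒≢ xy ∷ ¬Any⇒All¬ _ (All-Disjoint⇒∉vertices disjoint (inj₁ refl)))
    ∷ ¬Any⇒All¬ _ (All-Disjoint⇒∉vertices disjoint (inj₂ refl))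
    ∷ matching⇒unique (edges , pairwise)

  unique⇒matching : AllEdges M → Unique (vertices M) → IsMatching G M
  unique⇒matching [] _ = [] , []
  unique⇒matching (xy ∷ edges) ((_ ∷ x∉M) ∷ y∉M ∷ unique)
    with edges′ , pairwise ← unique⇒matching edges unique =
    xy ∷ edges′ ,
    ∉vertices⇒All-Disjoint (λ { (inj₁ refl) → All¬⇒¬Any x∉M ; (inj₂ refl) → All¬⇒¬Any y∉M }) ∷ pairwise

  no-free-edge⇒maximal : IsMatching G N → (∀ {x y} → Adj G x y → x ∉ vertices N → y ∉ vertices N → ⊥) →
                         IsMaximalMatching G N
  no-free-edge⇒maximal {N = N} N-matching no-free-edge =
    N-matching , λ { M (M-edges , M-pairwise) (N⊆M , f , f∈M , f∉N) → extension-free M-edges M-pairwise N⊆M f∈M f∉N }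
    where
    extension-free : ∀ {M f} → AllEdges M → AllPairs Disjoint M → N ⊆ₘ M →
                     Any (SameEdge f) M → ¬ Any (SameEdge f) N → ⊥
    extension-free {f = f} M-edges M-pairwise N⊆M f∈M f∉N
      with f′ , f′∈M , f~f′ ← find f∈M
      = no-free-edge (Adj-resp-SameEdge (SameEdge-sym f~f′) (All.lookup M-edges f′∈M))
                     (unmatched (inj₁ refl)) (unmatched (inj₂ refl))
      where
      unmatched : u ∈ₑ f → u ∉ vertices N
      unmatched u∈f u∈N
        with e , e∈N , u∈e ← find (∈-vertices⁻ u∈N)
        with e′ , e′∈M , e~e′ ← find (All.lookup N⊆M e∈N)
        with refl ← shared-endpoint⇒≡ M-pairwise f′∈M e′∈M (∈ₑ-resp-SameEdge f~f′ u∈f) (∈ₑ-resp-SameEdge e~e′ u∈e)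
        = f∉N (lose e∈N (SameEdge-trans f~f′ (SameEdge-sym e~e′)))

  perfect-resp-vertices : IsPerfectMatching G P → AllEdges N → vertices P ↭ vertices N → IsPerfectMatching G N
  perfect-resp-vertices (P-matching , P-covers) N-edges σ =
    unique⇒matching N-edges (Unique-resp-↭ (matching⇒unique P-matching) σ) ,
    λ x → ∈-vertices⁻ (∈-resp-↭ σ (∈-vertices⁺ (P-covers x)))

  perfect-resp-↭ : IsPerfectMatching G P → P ↭ N → IsPerfectMatching G N
  perfect-resp-↭ perfect σ = perfect-resp-vertices perfect (All-resp-↭ σ (proj₁ (proj₁ perfect))) (vertices-↭ σ)

  perfect-resp-SameEdge : IsPerfectMatching G P → Pointwise SameEdge P N → IsPerfectMatching G N
  perfect-resp-SameEdge perfect ss =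
    perfect-resp-vertices perfect (AllEdges-resp-SameEdge ss (proj₁ (proj₁ perfect))) (vertices-resp-SameEdge ss)

  extract : IsPerfectMatching G P → Unique M → All (_∈ P) M →
            ∃ λ R → IsPerfectMatching G (M ++ R) × (∀ {e} → e ∈ P → e ∉ M → e ∈ R)
  extract perfect M-unique M⊆P with R , σ ← Unique⊆⇒↭++ M-unique M⊆P =
    R , perfect-resp-↭ perfect σ , ∈-↭-++⁻ σ

  Joined : Edge n → Edge n → Set
  Joined e f = ∃₂ λ x y → x ∈ₑ e × y ∈ₑ f × Adj G x y

  joined-refl : Adj G (proj₁ e) (proj₂ e) → Joined e e
  joined-refl xy = _ , _ , inj₁ refl , inj₂ refl , xy

  Equimatchable : Set
  Equimatchable = ∀ {M N} → IsMatching G M → IsMaximalMatching G N → length M ≤ length N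

  matchNumber≡minMatchNumber⇒equimatchable : ∀ {k} → IsMatchNumber G k → IsMinMatchNumber G k → Equimatchable
  matchNumber≡minMatchNumber⇒equimatchable (_ , maximum) (_ , minimal) M-matching N-maximal =
    ≤-trans (maximum _ M-matching) (minimal _ N-maximal)

  -- Alternating x Ms Ns y: a path from x to y whose edges, in order, come
  -- alternately from Ms and Ns, starting and ending in Ms; only the Ns are
  -- required to be edges of G.
  data Alternating : Fin n → List (Edge n) → List (Edge n) → Fin n → Set where
    end  : ∀ {x y} → Alternating x ((x , y) ∷ []) [] y
    step : ∀ {x y z w Ms Ns} → Adj G y z → Alternating z Ms Ns w →
           Alternating x ((x , y) ∷ Ms) ((y , z) ∷ Ns) w

  Alternating-edges : ∀ {Ms Ns} → Alternating u Ms Ns v → AllEdges Ns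
  Alternating-edges end = []
  Alternating-edges (step yz path) = yz ∷ Alternating-edges path

  Alternating-vertices : ∀ {Ms Ns} → Alternating u Ms Ns v → vertices Ms ↭ u ∷ v ∷ vertices Ns
  Alternating-vertices end = refl
  Alternating-vertices (step {x = x} {y} {z} {w} {Ns = Ns} _ path) =
    prep x (trans (prep y (Alternating-vertices path)) (shift w (y ∷ z ∷ []) (vertices Ns)))

  module _ (equimatchable : Equimatchable) where

    near-perfect⇒adjacent : IsPerfectMatching G P → AllEdges N → vertices P ↭ u ∷ v ∷ vertices N → ¬ ¬ Adj G u v
    near-perfect⇒adjacent {P = P} {N = N} {u = u} {v = v} (P-matching , P-covers) N-edges σ ¬uv =
      <⇒≱ (vertices-↭-∷∷⇒< σ) (equimatchable P-matching (no-free-edge⇒maximal N-matching no-free-edge))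
      where
      N-matching : IsMatching G N
      N-matching with _ ∷ _ ∷ N-unique ← Unique-resp-↭ (matching⇒unique P-matching) σ =
        unique⇒matching N-edges N-unique

      unmatched : ∀ {x} → x ∉ vertices N → x ≡ u ⊎ x ≡ v
      unmatched {x} x∉N with ∈-resp-↭ σ (∈-vertices⁺ (P-covers x))
      ... | here x≡u = inj₁ x≡u
      ... | there (here x≡v) = inj₂ x≡v
      ... | there (there x∈N) = contradiction x∈N x∉N

      no-free-edge : ∀ {x y} → Adj G x y → x ∉ vertices N → y ∉ vertices N → ⊥
      no-free-edge xy x∉N y∉N with unmatched x∉N | unmatched y∉N
      ... | inj₁ refl | inj₁ refl = irrefl G xy
      ... | inj₁ refl | inj₂ refl = ¬uv xy
      ... | inj₂ refl | inj₁ refl = ¬uv (sym G xy)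
      ... | inj₂ refl | inj₂ refl = irrefl G xy

    alternating⇒adjacent : ∀ {Ms Ns} → IsPerfectMatching G (Ms ++ R) → Alternating u Ms Ns v → ¬ ¬ Adj G u v
    alternating⇒adjacent {R = R} {u = u} {v = v} {Ms = Ms} {Ns = Ns} perfect path =
      near-perfect⇒adjacent perfect (++⁺ (Alternating-edges path) (++⁻ʳ Ms (proj₁ (proj₁ perfect)))) (begin
        vertices (Ms ++ R)               ≡⟨ vertices-++ Ms ⟩
        vertices Ms ++ vertices R        ↭⟨ ++⁺ʳ (vertices R) (Alternating-vertices path) ⟩
        u ∷ v ∷ vertices Ns ++ vertices R ≡⟨ cong (λ vs → u ∷ v ∷ vs) (vertices-++ Ns) ⟨
        u ∷ v ∷ vertices (Ns ++ R)        ∎)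
      where open PermutationReasoning

    rematch : IsPerfectMatching G ((u′ , u) ∷ (v , v′) ∷ R) → Adj G u v →
              ¬ ¬ IsPerfectMatching G ((u , v) ∷ (u′ , v′) ∷ R)
    rematch {u′} {u} {v} perfect@((_ ∷ _ ∷ R-edges , _) , _) uv = do
      u′v′ ← alternating⇒adjacent perfect (step uv end)
      return (perfect-resp-vertices perfect (uv ∷ u′v′ ∷ R-edges) (trans (swap u′ u refl) (prep u (swap u′ v refl))))

    insert-edge : IsPerfectMatching G P → Adj G u v →
                  ¬ ¬ ∃ λ R → IsPerfectMatching G ((u , v) ∷ R) × (∀ {e} → e ∈ P → Disjoint e (u , v) → e ∈ R)
    insert-edge {u = u} {v} perfect uv
      with eᵤ , eᵤ∈P , u∈eᵤ ← find (proj₂ perfect u)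
      with eᵥ , eᵥ∈P , v∈eᵥ ← find (proj₂ perfect v)
      with eᵤ ≟ₑ eᵥ
    ... | yes refl with R , perfect′ , rest ← extract perfect ([] ∷ []) (eᵤ∈P ∷ [])
      = return (R , perfect-resp-SameEdge perfect′ (endpoints⇒SameEdge u∈eᵤ v∈eᵥ (Adj⇒≢ uv) ∷ Pointwise.refl SameEdge-refl) ,
                λ {_} e∈P e#uv → rest e∈P (All¬⇒¬Any (Disjoint⇒≢ e#uv u∈eᵤ (inj₁ refl) ∷ [])))
    ... | no eᵤ≢eᵥ
      with u′ , eᵤ~uu′ ← ∈ₑ⇒SameEdge u∈eᵤ
      with v′ , eᵥ~vv′ ← ∈ₑ⇒SameEdge v∈eᵥ
      with R , perfect′ , rest ← extract perfect ((eᵤ≢eᵥ ∷ []) ∷ [] ∷ []) (eᵤ∈P ∷ eᵥ∈P ∷ [])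
      = do perfect″ ← rematch (perfect-resp-SameEdge perfect′
                                 (SameEdge-trans eᵤ~uu′ (inj₂ refl) ∷ eᵥ~vv′ ∷ Pointwise.refl SameEdge-refl)) uv
           return ((u′ , v′) ∷ R , perfect″ , λ {_} e∈P e#uv → there (rest e∈P
             (All¬⇒¬Any (Disjoint⇒≢ e#uv u∈eᵤ (inj₁ refl) ∷ Disjoint⇒≢ e#uv v∈eᵥ (inj₂ refl) ∷ []))))

    -- If t = z′ then x′ x z z′ w w′ is alternating; if t = z, the alternating
    -- path x′ x z z′ gives the edge x′z′, which makes x x′ z′ z w w′ alternating.
    chain-adjacent : ∀ {x x′ z z′ t w w′} → IsPerfectMatching G ((x′ , x) ∷ (z , z′) ∷ (w , w′) ∷ R) →
                     Adj G x z → t ≡ z ⊎ t ≡ z′ → Adj G t w → ¬ ¬ (Adj G x′ w′ ⊎ Adj G x w′)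
    chain-adjacent perfect xz (inj₂ refl) z′w = inj₁ <$> alternating⇒adjacent perfect (step xz (step z′w end))
    chain-adjacent perfect xz (inj₁ refl) zw = do
      x′z′ ← alternating⇒adjacent perfect (step xz end)
      inj₂ <$> alternating⇒adjacent (perfect-resp-SameEdge perfect (inj₂ refl ∷ inj₂ refl ∷ Pointwise.refl SameEdge-refl))
                                    (step x′z′ (step zw end))

    joined-trans-distinct : ∀ {g} → IsPerfectMatching G (e ∷ f ∷ g ∷ R) → Joined e f → Joined f g → ¬ ¬ Joined e g
    joined-trans-distinct {e = e} {R = R} {g = g} perfect (x , z , x∈e , z∈f , xz) (t , w , t∈f , w∈g , tw)
      with x′ , e~xx′ ← ∈ₑ⇒SameEdge x∈e
      with z′ , f~zz′ ← ∈ₑ⇒SameEdge z∈f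
      with w′ , g~ww′ ← ∈ₑ⇒SameEdge w∈g
      = Sum.[ (λ x′w′ → x′ , w′ , x′∈e , w′∈g , x′w′) , (λ xw′ → x , w′ , x∈e , w′∈g , xw′) ]
          <$> chain-adjacent oriented xz (∈ₑ-resp-SameEdge f~zz′ t∈f) tw
      where
      oriented : IsPerfectMatching G ((x′ , x) ∷ (z , z′) ∷ (w , w′) ∷ R)
      oriented = perfect-resp-SameEdge perfect
                   (SameEdge-trans e~xx′ (inj₂ refl) ∷ f~zz′ ∷ g~ww′ ∷ Pointwise.refl SameEdge-refl)
      x′∈e : x′ ∈ₑ e
      x′∈e = ∈ₑ-resp-SameEdge (SameEdge-sym e~xx′) (inj₂ refl)
      w′∈g : w′ ∈ₑ g
      w′∈g = ∈ₑ-resp-SameEdge (SameEdge-sym g~ww′) (inj₂ refl)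

    joined-trans : IsPerfectMatching G P → e ∈ P → f ∈ P → g ∈ P → Joined e f → Joined f g → ¬ ¬ Joined e g
    joined-trans {e = e} {f = f} {g = g} perfect e∈P f∈P g∈P ef fg with e ≟ₑ f | f ≟ₑ g | e ≟ₑ g
    ... | yes refl | _        | _        = return fg
    ... | no _     | yes refl | _        = return ef
    ... | no _     | no _     | yes refl = return (joined-refl (All.lookup (proj₁ (proj₁ perfect)) e∈P))
    ... | no e≢f   | no f≢g   | no e≢g =
      let _ , perfect′ , _ = extract perfect distinct (e∈P ∷ f∈P ∷ g∈P ∷ []) in joined-trans-distinct perfect′ ef fg
      where
      distinct : Unique (e ∷ f ∷ g ∷ [])
      distinct = (e≢f ∷ e≢g ∷ []) ∷ (f≢g ∷ []) ∷ [] ∷ []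

    JoinedAt : List (Edge n) → Edge n → Fin n → Set
    JoinedAt P e x = ∃ λ f → f ∈ P × x ∈ₑ f × Joined e f

    joined-along-walk : IsPerfectMatching G P → e ∈ P → Walk G u v → ¬ ¬ JoinedAt P e u → ¬ ¬ JoinedAt P e v
    joined-along-walk perfect e∈P here joined = joined
    joined-along-walk perfect e∈P (step {v = w} uw walk) joined = joined-along-walk perfect e∈P walk do
      f , f∈P , u∈f , ef ← joined
      let g , g∈P , w∈g = find (proj₂ perfect w)
      eg ← joined-trans perfect e∈P f∈P g∈P ef (_ , _ , u∈f , w∈g , uw)
      return (g , g∈P , w∈g , eg)

    perfect⇒edges-joined : Connected G → IsPerfectMatching G P → e ∈ P → f ∈ P → ¬ ¬ Joined e f
    perfect⇒edges-joined {e = e} {f = f} connected perfect e∈P f∈P = do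
      f′ , f′∈P , x∈f′ , ef′ ← joined-along-walk perfect e∈P (connected (proj₁ e) (proj₁ f))
                                 (return (e , e∈P , inj₁ refl , joined-refl (All.lookup (proj₁ (proj₁ perfect)) e∈P)))
      return (≡.subst (Joined e) (shared-endpoint⇒≡ (proj₂ (proj₁ perfect)) f′∈P f∈P x∈f′ (inj₁ refl)) ef′)

    induced-pair⇒¬perfect : Connected G → IsInducedMatching G (e ∷ f ∷ M) → ¬ IsPerfectMatching G P
    induced-pair⇒¬perfect {e = e} {f = f} connected ((e-edge ∷ f-edge ∷ _ , (e#f ∷ _) ∷ _) , (e⋈̸f ∷ _) ∷ _) perfect =
      insert-edge perfect e-edge λ (_ , perfect₁ , _) →
      insert-edge perfect₁ f-edge λ (_ , perfect₂ , kept) →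
      perfect⇒edges-joined connected perfect₂ (there (kept (here refl) e#f)) (here refl) λ (x , y , x∈e , y∈f , xy) →
      e⋈̸f x y x∈e y∈f xy

corollary2p2 : ∀ {n} (G : Graph n) → Connected G →
    (∃ λ i → IsIndMatchNumber G i × 2 ≤ i) →
    (∃ λ k → IsMatchNumber G k × IsMinMatchNumber G k) →
    ¬ (∃ λ (M : List (Edge n)) → IsPerfectMatching G M)
corollary2p2 G connected (_ , ((_ ∷ _ ∷ _ , induced , _) , _) , _) (_ , match , minMatch) (_ , perfect) =
  induced-pair⇒¬perfect G (matchNumber≡minMatchNumber⇒equimatchable G match minMatch) connected induced perfect
corollary2p2 G _ (_ , (([] , _ , refl) , _) , ()) _ _
corollary2p2 G _ (_ , ((_ ∷ [] , _ , refl) , _) , s≤s ()) _ _
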